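{- For every integer $n\ge1$, the Boolean dimension of the path on $n$ vertices is $n-1$. Every graph on $n\ge 2$ vertices which is not isomorphic to a path has Boolean dimension at most $n-2$.
   Context: The path on $n$ vertices has vertex set $\{0,\dots,n-1\}$ and edges $\{i,i+1\}$ for $i<n-1$. The Boolean dimension $\dim_{Bool}(G)$ of a graph $G$ is the least cardinal $\kappa$ such that there is a family of $\kappa$ subsets $C_i\subseteq V(G)$ such that a pair of distinct vertices is an edge of $G$ iff it is contained in a finite and odd number of the $C_i$. -}

module Defs where

open import Data.Bool using (Bool; true; false; _∧_; _∨_; _xor_; not)
open import Data.Bool.Properties using (∨-comm)
open import Data.Nat using (ℕ; zero; suc; _≡ᵇ_; _≤_; _∸_)
open import Data.Fin using (Fin; toℕ)
open import Data.Product using (Σ; _×_; _,_; ∃)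
open import Function.Bundles using (_↔_; Inverse)
open import Relation.Binary.PropositionalEquality using (_≡_; _≢_; refl)

record Graph (n : ℕ) : Set where
  field
    adj     : Fin n → Fin n → Bool
    adj-sym : ∀ u v → adj u v ≡ adj v u
    adj-irr : ∀ u → adj u u ≡ false
open Graph public

pathAdj : ∀ {n} → Fin n → Fin n → Bool
pathAdj u v = (suc (toℕ u) ≡ᵇ toℕ v) ∨ (suc (toℕ v) ≡ᵇ toℕ u)

private
  suc≢ᵇ : ∀ m → (suc m ≡ᵇ m) ≡ false
  suc≢ᵇ zero = refl
  suc≢ᵇ (suc m) = suc≢ᵇ m

pathGraph : (n : ℕ) → Graph n
pathGraph n = record
  { adj = pathAdj
  ; adj-sym = λ u v → ∨-comm (suc (toℕ u) ≡ᵇ toℕ v) (suc (toℕ v) ≡ᵇ toℕ u)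
  ; adj-irr = λ u → irr (toℕ u) }
  where
  irr : ∀ m → ((suc m ≡ᵇ m) ∨ (suc m ≡ᵇ m)) ≡ false
  irr m rewrite suc≢ᵇ m = refl

_≅_ : ∀ {n} → Graph n → Graph n → Set
_≅_ {n} G H = Σ (Fin n ↔ Fin n) λ f →
  ∀ u v → adj G u v ≡ adj H (Inverse.to f u) (Inverse.to f v)

oddCount : ∀ {k} → (Fin k → Bool) → Bool
oddCount {zero}  p = false
oddCount {suc k} p = p Fin.zero xor oddCount (λ i → p (Fin.suc i))

-- A Boolean representation of G by a family of k subsets C_i ⊆ V(G)
-- (a subset is its characteristic function): distinct u, v are adjacent
-- iff they lie together in an odd number of the C_i.
BoolRep : ∀ {n} → Graph n → (k : ℕ) → Set
BoolRep {n} G k = Σ (Fin k → Fin n → Bool) λ C →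
  ∀ u v → u ≢ v → adj G u v ≡ oddCount (λ i → C i u ∧ C i v)

BoolDim≡ : ∀ {n} → Graph n → ℕ → Set
BoolDim≡ G k = BoolRep G k × (∀ m → BoolRep G m → k ≤ m)

BoolDim≤ : ∀ {n} → Graph n → ℕ → Set
BoolDim≤ G k = ∃ λ m → m ≤ k × BoolRep G m

-- The path on n vertices is represented by the n - 1 sets {i, i+1}. Conversely, in any
-- representation the characteristic vectors of the vertices i and j + 1 (i, j < n - 1) have
-- GF(2) inner product 1 for i = j and 0 for i < j; an upper unitriangular matrix has full rank,
-- so at least n - 1 sets are needed.
--
-- Eliminating a vertex v (toggling adjacency between any two of its neighbours and deleting v)
-- turns a representation of the smaller graph into one of G with a single extra set, the closed
-- neighbourhood of v. Hence, by induction on n, a graph G with n vertices has a representation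
-- with n - 2 sets unless every elimination of G is a path. In that case a vertex not adjacent to
-- the eliminated one keeps its neighbourhood in the path, and a case analysis on the degrees of G
-- shows that G is a path itself.
module Submission where

open import Defs
open import Algebra.Bundles using (CommutativeRing)
open import Data.Bool using (Bool; true; false; _∧_; _xor_; not)
open import Data.Bool.Properties
  using (∧-comm; ∧-assoc; ∧-zeroʳ; ∧-conicalˡ; ∧-distribʳ-xor; xor-assoc; xor-comm; xor-identityʳ;
         xor-same; xor-annihilates-not; xor-∧-commutativeRing; ¬-not; ⇔→≡; T-≡; T-∨)
open import Algebra.Properties.CommutativeSemigroup
  (CommutativeRing.+-commutativeSemigroup xor-∧-commutativeRing) using (interchange)
open import Data.Empty using (⊥; ⊥-elim)
open import Data.Fin as Fin using (Fin; zero; suc; toℕ; inject₁; fromℕ; opposite; punchIn; punchOut)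
open import Data.Fin.Permutation as Perm
  using (Permutation; insert; insert-punchIn; reverse; _∘ₚ_; _⟨$⟩ʳ_; _⟨$⟩ˡ_; inverseˡ; inverseʳ)
open import Data.Fin.Properties
  using (_≟_; suc-injective; toℕ-injective; toℕ-inject₁; toℕ<n; <⇒≢; punchInᵢ≢i; punchIn-injective;
         punchIn-punchOut; opposite-prop; opposite-involutive)
open import Data.Nat using (ℕ; zero; suc; _≤_; _∸_; _+_; z≤n; s≤s)
open import Data.Nat.Properties as ℕₚ using (≤-refl; <⇒≤; ≡ᵇ⇒≡; ≡⇒≡ᵇ; m∸n+n≡m; +-suc; +-cancelˡ-≡)
open import Data.Product using (∃; ∃₂; _×_; _,_; proj₁; proj₂)
open import Data.Sum as Sum using (_⊎_; inj₁; inj₂)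
open import Data.Vec.Functional using (insertAt)
open import Data.Vec.Functional.Properties using (insertAt-lookup; insertAt-punchIn)
open import Function using (_∘_; Equivalence; mk⇔)
open import Relation.Nullary using (¬_; yes; no; does)
open import Relation.Nullary.Decidable using (dec-true; dec-false)
open import Relation.Nullary.Negation using (contradiction)
open import Relation.Binary.PropositionalEquality
  using (_≡_; _≢_; refl; sym; trans; cong; cong₂; subst; subst₂; module ≡-Reasoning)

open ≡-Reasoning

private
  variable
    k m n : ℕ

-- Parity and the GF(2) inner product

oddCount-false : (p : Fin k → Bool) → (∀ i → p i ≡ false) → oddCount p ≡ false
oddCount-false {zero}  p p≡false = refl
oddCount-false {suc k} p p≡false rewrite p≡false zero = oddCount-false (p ∘ suc) (p≡false ∘ suc)

oddCount-cong : (p q : Fin k → Bool) → (∀ i → p i ≡ q i) → oddCount p ≡ oddCount q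
oddCount-cong {zero}  p q p≡q = refl
oddCount-cong {suc k} p q p≡q = cong₂ _xor_ (p≡q zero) (oddCount-cong (p ∘ suc) (q ∘ suc) (p≡q ∘ suc))

oddCount-punchIn : (p : Fin (suc k) → Bool) (c : Fin (suc k)) →
                   oddCount p ≡ p c xor oddCount (p ∘ punchIn c)
oddCount-punchIn p zero = refl
oddCount-punchIn {suc k} p (suc c) = begin
  p zero xor oddCount (p ∘ suc)            ≡⟨ cong (p zero xor_) (oddCount-punchIn (p ∘ suc) c) ⟩
  p zero xor (p (suc c) xor rest)          ≡⟨ xor-assoc (p zero) _ _ ⟨
  (p zero xor p (suc c)) xor rest          ≡⟨ cong (_xor rest) (xor-comm (p zero) _) ⟩
  (p (suc c) xor p zero) xor rest          ≡⟨ xor-assoc (p (suc c)) _ _ ⟩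
  p (suc c) xor (p zero xor rest)          ∎
  where
  rest = oddCount (p ∘ suc ∘ punchIn c)

oddCount-xor : (p q : Fin k → Bool) → oddCount (λ i → p i xor q i) ≡ oddCount p xor oddCount q
oddCount-xor {zero}  p q = refl
oddCount-xor {suc k} p q = begin
  (p zero xor q zero) xor oddCount (λ i → p (suc i) xor q (suc i))
    ≡⟨ cong ((p zero xor q zero) xor_) (oddCount-xor (p ∘ suc) (q ∘ suc)) ⟩
  (p zero xor q zero) xor (oddCount (p ∘ suc) xor oddCount (q ∘ suc))
    ≡⟨ interchange (p zero) (q zero) _ _ ⟩
  (p zero xor oddCount (p ∘ suc)) xor (q zero xor oddCount (q ∘ suc)) ∎

oddCount-∧ˡ : ∀ t (p : Fin k → Bool) → oddCount (λ i → t ∧ p i) ≡ t ∧ oddCount p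
oddCount-∧ˡ {k} false p = oddCount-false {k} (λ _ → false) (λ _ → refl)
oddCount-∧ˡ true  p = refl

oddCount≡true⇒∃ : (p : Fin k → Bool) → oddCount p ≡ true → ∃ λ i → p i ≡ true
oddCount≡true⇒∃ {suc k} p odd with p zero in p₀
... | true  = zero , p₀
... | false = let i , pᵢ = oddCount≡true⇒∃ (p ∘ suc) odd in suc i , pᵢ

infix 7 _·_

_·_ : (Fin m → Bool) → (Fin m → Bool) → Bool
x · y = oddCount (λ c → x c ∧ y c)

xor-cancelʳ : ∀ a s → (a xor s) xor s ≡ a
xor-cancelʳ a s = trans (xor-assoc a s s) (trans (cong (a xor_) (xor-same s)) (xor-identityʳ a))

-- A step of Gaussian elimination over GF(2): coordinate c of x is cleared with a row r, r c ≡ true.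
·-eliminate : (r x y : Fin (suc m) → Bool) (c : Fin (suc m)) → r c ≡ true →
              (λ j → x (punchIn c j) xor (x c ∧ r (punchIn c j))) · (y ∘ punchIn c)
              ≡ x · y xor (x c ∧ r · y)
·-eliminate r x y c rc≡true = begin
  oddCount (λ j → (x′ j xor (x c ∧ r′ j)) ∧ y′ j)
    ≡⟨ oddCount-cong (λ j → (x′ j xor (x c ∧ r′ j)) ∧ y′ j) _
                     (λ j → distrib (x′ j) (x c) (r′ j) (y′ j)) ⟩
  oddCount (λ j → (x′ j ∧ y′ j) xor (x c ∧ (r′ j ∧ y′ j)))
    ≡⟨ oddCount-xor (λ j → x′ j ∧ y′ j) (λ j → x c ∧ (r′ j ∧ y′ j)) ⟩
  x′ · y′ xor oddCount (λ j → x c ∧ (r′ j ∧ y′ j))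
    ≡⟨ cong (x′ · y′ xor_) (oddCount-∧ˡ (x c) (λ j → r′ j ∧ y′ j)) ⟩
  x′ · y′ xor (x c ∧ r′ · y′)
    ≡⟨ restore (x c) (y c) (x′ · y′) (r′ · y′) ⟩
  ((x c ∧ y c) xor x′ · y′) xor (x c ∧ (y c xor r′ · y′))
    ≡⟨ cong₂ (λ s t → s xor (x c ∧ t)) (oddCount-punchIn (λ j → x j ∧ y j) c)
             (trans (oddCount-punchIn (λ j → r j ∧ y j) c)
                    (cong (λ t → (t ∧ y c) xor r′ · y′) rc≡true)) ⟨
  x · y xor (x c ∧ r · y) ∎
  where
  x′ r′ y′ : Fin _ → Bool
  x′ = x ∘ punchIn c
  r′ = r ∘ punchIn c
  y′ = y ∘ punchIn c
  distrib : ∀ a t b z → (a xor (t ∧ b)) ∧ z ≡ (a ∧ z) xor (t ∧ (b ∧ z))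
  distrib a t b z = trans (∧-distribʳ-xor z a (t ∧ b)) (cong ((a ∧ z) xor_) (∧-assoc t b z))
  restore : ∀ a b X R → X xor (a ∧ R) ≡ ((a ∧ b) xor X) xor (a ∧ (b xor R))
  restore false b     X R = refl
  restore true  false X R = refl
  restore true  true  X R = sym (xor-annihilates-not X R)

-- Clearing a coordinate c with a zero · b zero ≡ true keeps the matrix (a i · b j) unitriangular.
unitriangular⇒≤ : (a b : Fin k → Fin m → Bool) →
                  (∀ i → a i · b i ≡ true) → (∀ {i j} → i Fin.< j → a i · b j ≡ false) → k ≤ m
unitriangular⇒≤ {zero}          a b diag upper = z≤n
unitriangular⇒≤ {suc k} {zero}  a b diag upper with diag zero
... | ()
unitriangular⇒≤ {suc k} {suc m} a b diag upper = s≤s (unitriangular⇒≤ a′ b′ diag′ upper′)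
  where
  pivot : ∃ λ c → a zero c ∧ b zero c ≡ true
  pivot = oddCount≡true⇒∃ (λ c → a zero c ∧ b zero c) (diag zero)
  c : Fin (suc m)
  c = proj₁ pivot
  a₀c : a zero c ≡ true
  a₀c = ∧-conicalˡ _ _ (proj₂ pivot)
  a′ b′ : Fin k → Fin m → Bool
  a′ i j = a (suc i) (punchIn c j) xor (a (suc i) c ∧ a zero (punchIn c j))
  b′ j = b (suc j) ∘ punchIn c
  reduced : ∀ i j → a′ i · b′ j ≡ a (suc i) · b (suc j) xor (a (suc i) c ∧ a zero · b (suc j))
  reduced i j = ·-eliminate (a zero) (a (suc i)) (b (suc j)) c a₀c
  diag′ : ∀ i → a′ i · b′ i ≡ true
  diag′ i rewrite reduced i i | diag (suc i) | upper {zero} {suc i} (s≤s z≤n)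
                | ∧-zeroʳ (a (suc i) c) = refl
  upper′ : ∀ {i j} → i Fin.< j → a′ i · b′ j ≡ false
  upper′ {i} {j} i<j rewrite reduced i j | upper (s≤s i<j) | upper {zero} {suc j} (s≤s z≤n)
                           | ∧-zeroʳ (a (suc i) c) = refl

-- The Boolean dimension of the path

-- Here and below, pathAdj (suc u) (suc v) reduces to pathAdj u v.
pathSets : ∀ m → Fin m → Fin (suc m) → Bool
pathSets (suc m) zero    zero          = true
pathSets (suc m) zero    (suc zero)    = true
pathSets (suc m) zero    (suc (suc _)) = false
pathSets (suc m) (suc i) zero          = false
pathSets (suc m) (suc i) (suc u)       = pathSets m i u

pathSets-represent : ∀ m (u v : Fin (suc m)) → u ≢ v →
                     pathAdj u v ≡ (λ i → pathSets m i u) · (λ i → pathSets m i v)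
pathSets-represent zero    zero          zero          u≢v = contradiction refl u≢v
pathSets-represent (suc m) zero          zero          u≢v = contradiction refl u≢v
pathSets-represent (suc m) zero          (suc zero)    _   =
  sym (cong not (oddCount-false {m} (λ _ → false) (λ _ → refl)))
pathSets-represent (suc m) zero          (suc (suc v)) _   =
  sym (oddCount-false {m} (λ _ → false) (λ _ → refl))
pathSets-represent (suc m) (suc zero)    zero          _
  rewrite oddCount-false (λ i → pathSets m i zero ∧ false) (λ _ → ∧-zeroʳ _) = refl
pathSets-represent (suc m) (suc (suc u)) zero          _   =
  sym (oddCount-false (λ i → pathSets m i (suc u) ∧ false) (λ _ → ∧-zeroʳ _))
pathSets-represent (suc m) (suc zero)    (suc zero)    u≢v = contradiction refl u≢v
pathSets-represent (suc m) (suc zero)    (suc (suc v)) _   =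
  pathSets-represent m zero (suc v) λ ()
pathSets-represent (suc m) (suc (suc u)) (suc v)       u≢v =
  pathSets-represent m (suc u) v (u≢v ∘ cong suc)

pathRep : ∀ m → BoolRep (pathGraph (suc m)) m
pathRep m = pathSets m , pathSets-represent m

pathAdj-inject₁-suc : (i : Fin m) → pathAdj (inject₁ i) (suc i) ≡ true
pathAdj-inject₁-suc zero    = refl
pathAdj-inject₁-suc (suc i) = pathAdj-inject₁-suc i

pathAdj-inject₁-suc-< : {i j : Fin m} → i Fin.< j → pathAdj (inject₁ i) (suc j) ≡ false
pathAdj-inject₁-suc-< {i = zero}  {suc j} _         = refl
pathAdj-inject₁-suc-< {i = suc i} {suc j} (s≤s i<j) = pathAdj-inject₁-suc-< i<j

inject₁≢suc : {i j : Fin m} → i Fin.≤ j → inject₁ i ≢ suc j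
inject₁≢suc {i = i} {j} i≤j = <⇒≢ (s≤s (subst (_≤ toℕ j) (sym (toℕ-inject₁ i)) i≤j))

pathLowerBound : ∀ m k → BoolRep (pathGraph (suc m)) k → m ≤ k
pathLowerBound m k (C , rep) =
  unitriangular⇒≤ (λ i c → C c (inject₁ i)) (λ j c → C c (suc j)) diag upper
  where
  diag : ∀ i → (λ c → C c (inject₁ i)) · (λ c → C c (suc i)) ≡ true
  diag i = trans (sym (rep _ _ (inject₁≢suc ≤-refl))) (pathAdj-inject₁-suc i)
  upper : ∀ {i j} → i Fin.< j → (λ c → C c (inject₁ i)) · (λ c → C c (suc j)) ≡ false
  upper i<j = trans (sym (rep _ _ (inject₁≢suc (<⇒≤ i<j)))) (pathAdj-inject₁-suc-< i<j)

NoneTrue UniqueTrue TwoTrue ExactlyTwoTrue ThreeTrue : (Fin k → Bool) → Set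
NoneTrue p = ∀ i → p i ≡ false
UniqueTrue p = ∃ λ a → p a ≡ true × (∀ i → p i ≡ true → i ≡ a)
TwoTrue p = ∃₂ λ a b → a ≢ b × p a ≡ true × p b ≡ true
ExactlyTwoTrue p = ∃₂ λ a b → a ≢ b × p a ≡ true × p b ≡ true × (∀ i → p i ≡ true → i ≡ a ⊎ i ≡ b)
ThreeTrue p = ∃₂ λ a b → ∃ λ c → a ≢ b × a ≢ c × b ≢ c × p a ≡ true × p b ≡ true × p c ≡ true

classify : (p : Fin k → Bool) → NoneTrue p ⊎ UniqueTrue p ⊎ ExactlyTwoTrue p ⊎ ThreeTrue p
classify {zero}  p = inj₁ λ ()
classify {suc k} p with classify (p ∘ suc) | p zero in p₀
... | inj₁ none | false = inj₁ λ { zero → p₀ ; (suc i) → none i }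
... | inj₁ none | true = inj₂ (inj₁ (zero , p₀ , λ
  { zero _ → refl ; (suc i) pᵢ → contradiction (trans (sym pᵢ) (none i)) λ () }))
... | inj₂ (inj₁ (a , pa , only)) | false = inj₂ (inj₁ (suc a , pa , λ
  { zero p0 → contradiction (trans (sym p0) p₀) λ () ; (suc i) pᵢ → cong suc (only i pᵢ) }))
... | inj₂ (inj₁ (a , pa , only)) | true = inj₂ (inj₂ (inj₁ (zero , suc a , (λ ()) , p₀ , pa , λ
  { zero _ → inj₁ refl ; (suc i) pᵢ → inj₂ (cong suc (only i pᵢ)) })))
... | inj₂ (inj₂ (inj₁ (a , b , a≢b , pa , pb , only))) | false =
  inj₂ (inj₂ (inj₁ (suc a , suc b , a≢b ∘ suc-injective , pa , pb , λ
    { zero p0 → contradiction (trans (sym p0) p₀) λ ()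
    ; (suc i) pᵢ → Sum.map (cong suc) (cong suc) (only i pᵢ) })))
... | inj₂ (inj₂ (inj₁ (a , b , a≢b , pa , pb , _))) | true =
  inj₂ (inj₂ (inj₂ (zero , suc a , suc b , (λ ()) , (λ ()) , a≢b ∘ suc-injective , p₀ , pa , pb)))
... | inj₂ (inj₂ (inj₂ (a , b , c , a≢b , a≢c , b≢c , pa , pb , pc))) | _ =
  inj₂ (inj₂ (inj₂ (suc a , suc b , suc c , a≢b ∘ suc-injective , a≢c ∘ suc-injective ,
                    b≢c ∘ suc-injective , pa , pb , pc)))

atLeastTwo : {p : Fin k → Bool} → ExactlyTwoTrue p ⊎ ThreeTrue p → TwoTrue p
atLeastTwo (inj₁ (a , b , a≢b , pa , pb , _))         = a , b , a≢b , pa , pb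
atLeastTwo (inj₂ (a , b , _ , a≢b , _ , _ , pa , pb , _)) = a , b , a≢b , pa , pb

exactlyTwo-noThird : {p : Fin k → Bool} → ExactlyTwoTrue p → {x y z : Fin k} →
                     x ≢ y → x ≢ z → y ≢ z → p x ≡ true → p y ≡ true → p z ≡ true → ⊥
exactlyTwo-noThird (_ , _ , _ , _ , _ , only) {x} {y} {z} x≢y x≢z y≢z px py pz
  with only x px | only y py | only z pz
... | inj₁ refl | inj₁ refl | _         = x≢y refl
... | inj₂ refl | inj₂ refl | _         = x≢y refl
... | inj₁ refl | inj₂ refl | inj₁ refl = x≢z refl
... | inj₁ refl | inj₂ refl | inj₂ refl = y≢z refl
... | inj₂ refl | inj₁ refl | inj₁ refl = y≢z refl
... | inj₂ refl | inj₁ refl | inj₂ refl = x≢z refl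

∃⊎∀ : {P Q : Fin k → Set} → (∀ i → P i ⊎ Q i) → ∃ P ⊎ (∀ i → Q i)
∃⊎∀ {zero}  h = inj₂ λ ()
∃⊎∀ {suc k} h with h zero | ∃⊎∀ (h ∘ suc)
... | inj₁ p | _            = inj₁ (zero , p)
... | inj₂ _ | inj₁ (i , p) = inj₁ (suc i , p)
... | inj₂ q | inj₂ qs      = inj₂ λ { zero → q ; (suc i) → qs i }

adj⇒≢ : (G : Graph n) {x y : Fin n} → adj G x y ≡ true → x ≢ y
adj⇒≢ G {x} x~y refl = contradiction (trans (sym x~y) (adj-irr G x)) λ ()

_─_ : ℕ → ℕ → Set
a ─ b = suc a ≡ b ⊎ suc b ≡ a

pathAdj⇒─ : {u v : Fin n} → pathAdj u v ≡ true → toℕ u ─ toℕ v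
pathAdj⇒─ u~v = Sum.map (≡ᵇ⇒≡ _ _) (≡ᵇ⇒≡ _ _) (Equivalence.to T-∨ (Equivalence.from T-≡ u~v))

─⇒pathAdj : {u v : Fin n} → toℕ u ─ toℕ v → pathAdj u v ≡ true
─⇒pathAdj u─v = Equivalence.to T-≡ (Equivalence.from T-∨ (Sum.map (≡⇒≡ᵇ _ _) (≡⇒≡ᵇ _ _) u─v))

─-triangle : {a b c : ℕ} → a ─ b → b ─ c → a ─ c → ⊥
─-triangle (inj₁ refl) (inj₁ refl) (inj₁ ())
─-triangle (inj₁ refl) (inj₁ refl) (inj₂ ())
─-triangle (inj₁ refl) (inj₂ refl) (inj₁ ())
─-triangle (inj₁ refl) (inj₂ refl) (inj₂ ())
─-triangle (inj₂ refl) (inj₁ refl) (inj₁ ())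
─-triangle (inj₂ refl) (inj₁ refl) (inj₂ ())
─-triangle (inj₂ refl) (inj₂ refl) (inj₁ ())
─-triangle (inj₂ refl) (inj₂ refl) (inj₂ ())

─-three : {p a b c : ℕ} → p ─ a → p ─ b → p ─ c → a ≡ b ⊎ a ≡ c ⊎ b ≡ c
─-three (inj₁ refl) (inj₁ refl) _           = inj₁ refl
─-three (inj₂ refl) (inj₂ refl) _           = inj₁ refl
─-three (inj₁ refl) (inj₂ refl) (inj₁ refl) = inj₂ (inj₁ refl)
─-three (inj₁ refl) (inj₂ refl) (inj₂ refl) = inj₂ (inj₂ refl)
─-three (inj₂ refl) (inj₁ refl) (inj₁ refl) = inj₂ (inj₂ refl)
─-three (inj₂ refl) (inj₁ refl) (inj₂ refl) = inj₂ (inj₁ refl)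

path-triangleFree : (a b c : Fin n) → pathAdj a b ≡ true → pathAdj b c ≡ true → pathAdj a c ≡ true → ⊥
path-triangleFree a b c a~b b~c a~c =
  ─-triangle (pathAdj⇒─ {u = a} a~b) (pathAdj⇒─ {u = b} b~c) (pathAdj⇒─ {u = a} a~c)

path-degree≤2 : (k : Fin n) → ¬ ThreeTrue (pathAdj k)
path-degree≤2 k (a , b , c , a≢b , a≢c , b≢c , k~a , k~b , k~c) =
  Sum.[ a≢b ∘ toℕ-injective , Sum.[ a≢c ∘ toℕ-injective , b≢c ∘ toℕ-injective ] ]
    (─-three (pathAdj⇒─ {v = a} k~a) (pathAdj⇒─ {v = b} k~b) (pathAdj⇒─ {v = c} k~c))

path-start-degree≤1 : ¬ TwoTrue (pathAdj {suc n} zero)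
path-start-degree≤1 (zero         , _             , _   , ()  , _)
path-start-degree≤1 (suc (suc _)  , _             , _   , ()  , _)
path-start-degree≤1 (suc zero     , zero          , _   , _   , ())
path-start-degree≤1 (suc zero     , suc (suc _)   , _   , _   , ())
path-start-degree≤1 (suc zero     , suc zero      , a≢b , _   , _) = a≢b refl

path-hasNeighbour : (k : Fin (2 + n)) → ∃ λ l → pathAdj k l ≡ true
path-hasNeighbour zero = suc zero , refl
path-hasNeighbour (suc zero) = zero , refl
path-hasNeighbour {suc n} (suc (suc k)) = let l , k~l = path-hasNeighbour (suc k) in suc l , k~l

path-endOrInterior : (k : Fin (suc n)) → k ≡ zero ⊎ k ≡ fromℕ n ⊎ TwoTrue (pathAdj k)
path-endOrInterior zero = inj₁ refl
path-endOrInterior {suc zero} (suc zero) = inj₂ (inj₁ refl)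
path-endOrInterior {suc (suc n)} (suc zero) =
  inj₂ (inj₂ (zero , suc (suc zero) , (λ ()) , refl , refl))
path-endOrInterior {suc (suc n)} (suc (suc k)) with path-endOrInterior (suc k)
... | inj₂ (inj₁ k≡end) = inj₂ (inj₁ (cong suc k≡end))
... | inj₂ (inj₂ (a , b , a≢b , k~a , k~b)) =
  inj₂ (inj₂ (suc a , suc b , a≢b ∘ suc-injective , k~a , k~b))

opposite+suc : (a : Fin n) → toℕ (opposite a) + suc (toℕ a) ≡ n
opposite+suc a = trans (cong (_+ suc (toℕ a)) (opposite-prop a)) (m∸n+n≡m (toℕ<n a))

─-reflect : {x y a b : ℕ} → x + suc a ≡ y + suc b → suc x ≡ y → suc b ≡ a
─-reflect {x} {a = a} {b} x+a≡y+b refl =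
  sym (ℕₚ.suc-injective (+-cancelˡ-≡ x _ _ (trans x+a≡y+b (sym (+-suc x (suc b))))))

pathAdj-opposite⇒ : (a b : Fin n) → pathAdj (opposite a) (opposite b) ≡ true → pathAdj a b ≡ true
pathAdj-opposite⇒ a b a′~b′ = ─⇒pathAdj (Sum.swap (Sum.map (─-reflect sums) (─-reflect (sym sums))
                                                            (pathAdj⇒─ {u = opposite a} a′~b′)))
  where
  sums : toℕ (opposite a) + suc (toℕ a) ≡ toℕ (opposite b) + suc (toℕ b)
  sums = trans (opposite+suc a) (sym (opposite+suc b))

pathAdj-opposite : (a b : Fin n) → pathAdj (opposite a) (opposite b) ≡ pathAdj a b
pathAdj-opposite a b = ⇔→≡ (mk⇔ (pathAdj-opposite⇒ a b) λ a~b →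
  pathAdj-opposite⇒ (opposite a) (opposite b)
    (subst₂ (λ x y → pathAdj x y ≡ true) (sym (opposite-involutive a)) (sym (opposite-involutive b))
            a~b))

reverse-≅ : {H : Graph n} → H ≅ pathGraph n → H ≅ pathGraph n
reverse-≅ (π , π-adj) =
  π ∘ₚ reverse , λ x y → trans (π-adj x y) (sym (pathAdj-opposite (π ⟨$⟩ʳ x) (π ⟨$⟩ʳ y)))

path-end-degree≤1 : ¬ TwoTrue (pathAdj (fromℕ n))
path-end-degree≤1 {n} (a , b , a≢b , e~a , e~b) =
  path-start-degree≤1
    (opposite a , opposite b , a≢b ∘ opposite-injective , from-end a e~a , from-end b e~b)
  where
  opposite-injective : {x y : Fin (suc n)} → opposite x ≡ opposite y → x ≡ y
  opposite-injective {x} {y} e =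
    trans (sym (opposite-involutive x)) (trans (cong opposite e) (opposite-involutive y))
  from-end : ∀ x → pathAdj (fromℕ n) x ≡ true → pathAdj zero (opposite x) ≡ true
  from-end x e~x = subst (λ z → pathAdj z (opposite x) ≡ true) (opposite-involutive zero)
                         (trans (pathAdj-opposite (fromℕ n) x) e~x)

-- Elimination of a vertex

pivotAdj : Graph (suc n) → Fin (suc n) → Fin (suc n) → Fin (suc n) → Bool
pivotAdj G v x y = adj G x y xor (adj G v x ∧ adj G v y)

does-≟-sym : (i j : Fin n) → does (i ≟ j) ≡ does (j ≟ i)
does-≟-sym i j with i ≟ j | j ≟ i
... | yes _   | yes _   = refl
... | no  _   | no  _   = refl
... | yes i≡j | no  j≢i = contradiction (sym i≡j) j≢i
... | no  i≢j | yes j≡i = contradiction (sym j≡i) i≢j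

eliminate : Graph (suc n) → Fin (suc n) → Graph n
eliminate G v = record
  { adj     = λ i j → not (does (i ≟ j)) ∧ pivotAdj G v (punchIn v i) (punchIn v j)
  ; adj-sym = λ i j → cong₂ _∧_ (cong not (does-≟-sym i j))
                        (cong₂ _xor_ (adj-sym G _ _) (∧-comm (adj G v (punchIn v i)) _))
  ; adj-irr = λ i → cong (λ b → not b ∧ pivotAdj G v (punchIn v i) (punchIn v i))
                         (dec-true (i ≟ i) refl)
  }

adj-eliminate : (G : Graph (suc n)) (v : Fin (suc n)) {i j : Fin n} → i ≢ j →
                adj (eliminate G v) i j ≡ pivotAdj G v (punchIn v i) (punchIn v j)
adj-eliminate G v {i} {j} i≢j =
  cong (λ b → not b ∧ pivotAdj G v (punchIn v i) (punchIn v j)) (dec-false (i ≟ j) i≢j)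

punchIn-view : (v u : Fin (suc n)) → v ≡ u ⊎ ∃ λ j → punchIn v j ≡ u
punchIn-view v u with v ≟ u
... | yes v≡u = inj₁ v≡u
... | no  v≢u = inj₂ (punchOut v≢u , punchIn-punchOut v≢u)

liftRep : (G : Graph (suc n)) (v : Fin (suc n)) → BoolRep (eliminate G v) m → BoolRep G (suc m)
liftRep {n} {m} G v (C , rep) = C⁺ , rep⁺
  where
  C⁺ : Fin (suc m) → Fin (suc n) → Bool
  C⁺ zero    = insertAt (adj G v ∘ punchIn v) v true
  C⁺ (suc i) = insertAt (C i) v false

  rep-v : ∀ j → adj G v (punchIn v j) ≡ (λ i → C⁺ i v) · (λ i → C⁺ i (punchIn v j))
  rep-v j rewrite insertAt-lookup (adj G v ∘ punchIn v) v true
                | insertAt-punchIn (adj G v ∘ punchIn v) v true j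
                | oddCount-false (λ i → C⁺ (suc i) v ∧ C⁺ (suc i) (punchIn v j))
                                 (λ i → cong (_∧ C⁺ (suc i) (punchIn v j))
                                             (insertAt-lookup (C i) v false))
                = sym (xor-identityʳ _)

  rep-punchIn : ∀ {i j} → i ≢ j → adj G (punchIn v i) (punchIn v j)
                                  ≡ (λ l → C⁺ l (punchIn v i)) · (λ l → C⁺ l (punchIn v j))
  rep-punchIn {i} {j} i≢j = begin
    adj G x y                               ≡⟨ xor-cancelʳ _ s ⟨
    (adj G x y xor s) xor s                 ≡⟨ xor-comm _ s ⟩
    s xor pivotAdj G v x y                  ≡⟨ cong (s xor_) (adj-eliminate G v i≢j) ⟨
    s xor adj (eliminate G v) i j           ≡⟨ cong (s xor_) (rep i j i≢j) ⟩
    s xor (λ l → C l i) · (λ l → C l j)     ≡⟨ cong₂ _xor_ first-set other-sets ⟨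
    (λ l → C⁺ l x) · (λ l → C⁺ l y)         ∎
    where
    x = punchIn v i
    y = punchIn v j
    s = adj G v x ∧ adj G v y
    first-set : C⁺ zero x ∧ C⁺ zero y ≡ s
    first-set = cong₂ _∧_ (insertAt-punchIn _ v true i) (insertAt-punchIn _ v true j)
    other-sets : (λ l → C⁺ (suc l) x) · (λ l → C⁺ (suc l) y) ≡ (λ l → C l i) · (λ l → C l j)
    other-sets = oddCount-cong _ _ λ l →
      cong₂ _∧_ (insertAt-punchIn (C l) v false i) (insertAt-punchIn (C l) v false j)

  rep⁺ : ∀ x y → x ≢ y → adj G x y ≡ (λ i → C⁺ i x) · (λ i → C⁺ i y)
  rep⁺ x y x≢y with punchIn-view v x | punchIn-view v y
  ... | inj₁ refl | inj₁ refl = contradiction refl x≢y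
  ... | inj₁ refl | inj₂ (j , refl) = rep-v j
  ... | inj₂ (i , refl) | inj₁ refl =
    trans (adj-sym G _ _)
          (trans (rep-v i) (oddCount-cong _ _ λ l → ∧-comm (C⁺ l v) (C⁺ l (punchIn v i))))
  ... | inj₂ (i , refl) | inj₂ (j , refl) = rep-punchIn (x≢y ∘ cong (punchIn v))

-- An isomorphism from the elimination of v to the path labels the vertices u ≢ v by path
-- positions; the edges of G between labels are those of the path, toggled where both ends are
-- attached to v.
module Labelling {n} (G : Graph (3 + n)) (v : Fin (3 + n))
                 (iso : eliminate G v ≅ pathGraph (2 + n)) where

  π : Permutation (2 + n) (2 + n)
  π = proj₁ iso

  label : Fin (2 + n) → Fin (3 + n)
  label k = punchIn v (π ⟨$⟩ˡ k)

  attached : Fin (2 + n) → Bool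
  attached k = adj G v (label k)

  label-injective : {k l : Fin (2 + n)} → label k ≡ label l → k ≡ l
  label-injective {k} {l} e =
    trans (sym (inverseʳ π)) (trans (cong (π ⟨$⟩ʳ_) (punchIn-injective v _ _ e)) (inverseʳ π))

  label-≢ : {k l : Fin (2 + n)} → k ≢ l → label k ≢ label l
  label-≢ k≢l = k≢l ∘ label-injective

  pivot≢label : (k : Fin (2 + n)) → v ≢ label k
  pivot≢label k = punchInᵢ≢i v (π ⟨$⟩ˡ k) ∘ sym

  view : ∀ u → v ≡ u ⊎ ∃ λ k → label k ≡ u
  view u with punchIn-view v u
  ... | inj₁ v≡u        = inj₁ v≡u
  ... | inj₂ (j , refl) = inj₂ (π ⟨$⟩ʳ j , cong (punchIn v) (inverseˡ π))

  position : {u : Fin (3 + n)} → v ≢ u → ∃ λ k → label k ≡ u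
  position {u} v≢u with view u
  ... | inj₁ v≡u = contradiction v≡u v≢u
  ... | inj₂ k   = k

  pathAdj-label : {k l : Fin (2 + n)} → k ≢ l → pathAdj k l ≡ pivotAdj G v (label k) (label l)
  pathAdj-label {k} {l} k≢l = begin
    pathAdj k l                                       ≡⟨ cong₂ pathAdj (inverseʳ π) (inverseʳ π) ⟨
    pathAdj (π ⟨$⟩ʳ (π ⟨$⟩ˡ k)) (π ⟨$⟩ʳ (π ⟨$⟩ˡ l))   ≡⟨ proj₂ iso _ _ ⟨
    adj (eliminate G v) (π ⟨$⟩ˡ k) (π ⟨$⟩ˡ l)
      ≡⟨ adj-eliminate G v (label-≢ k≢l ∘ cong (punchIn v)) ⟩
    pivotAdj G v (label k) (label l)                  ∎

  adj-label : {k l : Fin (2 + n)} → k ≢ l →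
              adj G (label k) (label l) ≡ pathAdj k l xor (attached k ∧ attached l)
  adj-label {k} {l} k≢l =
    trans (sym (xor-cancelʳ _ (attached k ∧ attached l)))
          (cong (_xor (attached k ∧ attached l)) (sym (pathAdj-label k≢l)))

  adj-label-free : {k l : Fin (2 + n)} → k ≢ l → attached l ≡ false →
                   adj G (label k) (label l) ≡ pathAdj k l
  adj-label-free {k} {l} k≢l l-free = begin
    adj G (label k) (label l)                  ≡⟨ adj-label k≢l ⟩
    pathAdj k l xor (attached k ∧ attached l)  ≡⟨ cong (λ b → pathAdj k l xor (attached k ∧ b)) l-free ⟩
    pathAdj k l xor (attached k ∧ false)       ≡⟨ cong (pathAdj k l xor_) (∧-zeroʳ (attached k)) ⟩
    pathAdj k l xor false                      ≡⟨ xor-identityʳ _ ⟩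
    pathAdj k l                                ∎

  unattached-neighbour : {k : Fin (2 + n)} {y : Fin (3 + n)} → attached k ≡ false →
                         adj G (label k) y ≡ true → ∃ λ l → label l ≡ y × pathAdj k l ≡ true
  unattached-neighbour {k} {y} k-free k~y with view y
  ... | inj₁ refl = contradiction (trans (sym k~y) (trans (adj-sym G _ _) k-free)) λ ()
  ... | inj₂ (l , refl) =
    l , refl , trans (pathAdj-label (adj⇒≢ G k~y ∘ cong label))
                     (cong₂ (λ a b → a xor (b ∧ attached l)) k~y k-free)

  unattached-TwoTrue : {k : Fin (2 + n)} → attached k ≡ false →
                       TwoTrue (adj G (label k)) → TwoTrue (pathAdj k)
  unattached-TwoTrue k-free (x , y , x≢y , k~x , k~y)
    with unattached-neighbour k-free k~x | unattached-neighbour k-free k~y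
  ... | a , refl , k~a | b , refl , k~b = a , b , x≢y ∘ cong label , k~a , k~b

  unattached-ThreeTrue : {k : Fin (2 + n)} → attached k ≡ false →
                         ThreeTrue (adj G (label k)) → ThreeTrue (pathAdj k)
  unattached-ThreeTrue k-free (x , y , z , x≢y , x≢z , y≢z , k~x , k~y , k~z)
    with unattached-neighbour k-free k~x | unattached-neighbour k-free k~y
       | unattached-neighbour k-free k~z
  ... | a , refl , k~a | b , refl , k~b | c , refl , k~c =
    a , b , c , x≢y ∘ cong label , x≢z ∘ cong label , y≢z ∘ cong label , k~a , k~b , k~c

  start-attached : (∀ u → TwoTrue (adj G u)) → attached zero ≡ true
  start-attached deg≥2 = ¬-not λ 0-free →
    path-start-degree≤1 (unattached-TwoTrue 0-free (deg≥2 (label zero)))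

  end-attached : (∀ u → TwoTrue (adj G u)) → attached (fromℕ (suc n)) ≡ true
  end-attached deg≥2 = ¬-not λ end-free →
    path-end-degree≤1 (unattached-TwoTrue end-free (deg≥2 (label (fromℕ (suc n)))))

  pivotAdj-triangleFree : {x y z : Fin (3 + n)} → v ≢ x → v ≢ y → v ≢ z → x ≢ y → y ≢ z → x ≢ z →
                          pivotAdj G v x y ≡ true → pivotAdj G v y z ≡ true → pivotAdj G v x z ≡ true → ⊥
  pivotAdj-triangleFree v≢x v≢y v≢z x≢y y≢z x≢z x~y y~z x~z
    with position v≢x | position v≢y | position v≢z
  ... | a , refl | b , refl | c , refl =
    path-triangleFree a b c (trans (pathAdj-label (x≢y ∘ cong label)) x~y)
                      (trans (pathAdj-label (y≢z ∘ cong label)) y~z)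
                      (trans (pathAdj-label (x≢z ∘ cong label)) x~z)

  pivotAdj-isolated⇒⊥ : {x : Fin (3 + n)} → v ≢ x →
                        (∀ y → v ≢ y → x ≢ y → pivotAdj G v x y ≡ false) → ⊥
  pivotAdj-isolated⇒⊥ v≢x isolated with position v≢x
  ... | k , refl =
    let l , k~l = path-hasNeighbour k
        k≢l = adj⇒≢ (pathGraph _) k~l
    in contradiction (trans (sym k~l) (trans (pathAdj-label k≢l)
                       (isolated (label l) (pivot≢label l) (label-≢ k≢l)))) λ ()

  leafAtStart⇒path : attached zero ≡ true → (∀ k → attached k ≡ true → k ≡ zero) →
                     G ≅ pathGraph (3 + n)
  leafAtStart⇒path 0-attached only-0 = σ , σ-adj
    where
    σ : Permutation (3 + n) (3 + n)
    σ = insert v zero π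

    σ-pivot : σ ⟨$⟩ʳ v ≡ zero
    σ-pivot with v ≟ v
    ... | yes _   = refl
    ... | no  v≢v = contradiction refl v≢v

    σ-label : ∀ k → σ ⟨$⟩ʳ label k ≡ suc k
    σ-label k = trans (insert-punchIn v zero π (π ⟨$⟩ˡ k)) (cong suc (inverseʳ π))

    attached-as-start : ∀ k → attached k ≡ pathAdj zero (suc k)
    attached-as-start zero    = 0-attached
    attached-as-start (suc k) = ¬-not λ sk-attached → contradiction (only-0 _ sk-attached) λ ()

    σ-adj : ∀ x y → adj G x y ≡ pathAdj (σ ⟨$⟩ʳ x) (σ ⟨$⟩ʳ y)
    σ-adj x y with view x | view y
    ... | inj₁ refl       | inj₁ refl       rewrite σ-pivot = adj-irr G v
    ... | inj₁ refl       | inj₂ (l , refl) rewrite σ-pivot | σ-label l = attached-as-start l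
    ... | inj₂ (k , refl) | inj₁ refl       rewrite σ-pivot | σ-label k =
      trans (adj-sym G _ _) (trans (attached-as-start k) (adj-sym (pathGraph (3 + n)) zero (suc k)))
    ... | inj₂ (k , refl) | inj₂ (l , refl) rewrite σ-label k | σ-label l with k ≟ l
    ...   | yes refl = trans (adj-irr G (label k)) (sym (adj-irr (pathGraph (2 + n)) k))
    ...   | no  k≢l  =
      trans (adj-label k≢l) (trans (cong (pathAdj k l xor_) not-both) (xor-identityʳ _))
      where
      not-both : attached k ∧ attached l ≡ false
      not-both with attached k in ek | attached l in el
      ... | false | _     = refl
      ... | true  | false = refl
      ... | true  | true  = contradiction (trans (only-0 k ek) (sym (only-0 l el))) k≢l

AllEliminationsPaths : Graph (3 + n) → Set
AllEliminationsPaths {n} G = ∀ v → eliminate G v ≅ pathGraph (2 + n)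

isolated⇒⊥ : (G : Graph (3 + n)) → AllEliminationsPaths G → ∀ v → ¬ NoneTrue (adj G v)
isolated⇒⊥ G paths v isolated = pivotAdj-isolated⇒⊥ (punchInᵢ≢i v zero) λ y _ _ → v-isolated y
  where
  u = punchIn v zero
  open Labelling G u (paths u)
  v-isolated : ∀ y → pivotAdj G u v y ≡ false
  v-isolated y rewrite isolated y | adj-sym G u v | isolated u = refl

-- Eliminating w turns the two further neighbours x, y of w and the leaf v into a triangle.
leaf-triangle⇒⊥ : (G : Graph (3 + n)) {v w x y : Fin (3 + n)} → eliminate G w ≅ pathGraph (2 + n) →
                  (∀ u → adj G v u ≡ true → u ≡ w) → adj G v w ≡ true →
                  adj G w x ≡ true → adj G w y ≡ true → x ≢ y → adj G x y ≡ false → v ≢ x → v ≢ y → ⊥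
leaf-triangle⇒⊥ G {v} {w} {x} {y} isoʷ only-w v~w w~x w~y x≢y x≁y v≢x v≢y =
  pivotAdj-triangleFree (adj⇒≢ G w~x) (adj⇒≢ G w~y) (adj⇒≢ G w~v) x≢y (v≢y ∘ sym) (v≢x ∘ sym)
                        x~y y~v x~v
  where
  open Labelling G w isoʷ
  w~v : adj G w v ≡ true
  w~v = trans (adj-sym G w v) v~w
  ≁v : ∀ {z} → adj G w z ≡ true → adj G z v ≡ false
  ≁v w~z = ¬-not λ z~v → adj⇒≢ G w~z (sym (only-w _ (trans (adj-sym G v _) z~v)))
  x~y : pivotAdj G w x y ≡ true
  x~y rewrite x≁y | w~x | w~y = refl
  y~v : pivotAdj G w y v ≡ true
  y~v rewrite ≁v w~y | w~y | w~v = refl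
  x~v : pivotAdj G w x v ≡ true
  x~v rewrite ≁v w~x | w~x | w~v = refl

leaf⇒path : (G : Graph (3 + n)) → AllEliminationsPaths G → ∀ v → UniqueTrue (adj G v) →
            G ≅ pathGraph (3 + n)
leaf⇒path {n} G paths v (w , v~w , only-w) =
  let i₀ , i₀↦w = position (adj⇒≢ G v~w)
  in  at i₀ (subst (λ u → adj G v u ≡ true) (sym i₀↦w) v~w)
            (λ u v~u → trans (only-w u v~u) (sym i₀↦w))
  where
  open Labelling G v (paths v)
  module R = Labelling G v (reverse-≅ {H = eliminate G v} (paths v))

  at : ∀ i₀ → attached i₀ ≡ true → (∀ u → adj G v u ≡ true → u ≡ label i₀) →
       G ≅ pathGraph (3 + n)
  at i₀ i₀-att only with path-endOrInterior i₀
  ... | inj₁ refl = leafAtStart⇒path i₀-att λ k k-att → label-injective (only _ k-att)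
  ... | inj₂ (inj₁ refl) = R.leafAtStart⇒path i₀-att λ k k-att → begin
    k                                ≡⟨ opposite-involutive k ⟨
    opposite (opposite k)            ≡⟨ cong opposite (label-injective (only _ k-att)) ⟩
    opposite (opposite zero)         ≡⟨ opposite-involutive zero ⟩
    zero                             ∎
  ... | inj₂ (inj₂ (a , b , a≢b , i₀~a , i₀~b)) =
    ⊥-elim (leaf-triangle⇒⊥ G (paths (label i₀)) only i₀-att (w~ i₀~a) (w~ i₀~b)
                            (label-≢ a≢b) a≁b (pivot≢label a) (pivot≢label b))
    where
    free : ∀ {k} → pathAdj i₀ k ≡ true → attached k ≡ false
    free i₀~k = ¬-not λ k-att → adj⇒≢ (pathGraph _) i₀~k (sym (label-injective (only _ k-att)))
    w~ : ∀ {k} → pathAdj i₀ k ≡ true → adj G (label i₀) (label k) ≡ true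
    w~ i₀~k = trans (adj-label-free (adj⇒≢ (pathGraph (2 + n)) i₀~k) (free i₀~k)) i₀~k
    a≁b : adj G (label a) (label b) ≡ false
    a≁b = trans (adj-label-free a≢b (free i₀~b))
                (¬-not λ a~b → path-triangleFree i₀ a b i₀~a a~b i₀~b)

-- Both ends of the path labelling G at v are attached to v (start-attached, end-attached), so
-- they are its two neighbours; for every length of the path, an elimination next to an end
-- then fails to be a path.
degreeTwo⇒⊥ : (G : Graph (3 + n)) → AllEliminationsPaths G → (∀ u → TwoTrue (adj G u)) →
              ∀ v → ¬ ExactlyTwoTrue (adj G v)
degreeTwo⇒⊥ {zero} G paths deg≥2 v _ =
  let x , y , x≢y , 0~x , 0~y = deg≥2 (label zero)
  in  x≢y (trans (only-pivot x 0~x) (sym (only-pivot y 0~y)))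
  where
  open Labelling G v (paths v)
  only-pivot : ∀ u → adj G (label zero) u ≡ true → u ≡ v
  only-pivot u 0~u with view u
  ... | inj₁ v≡u = sym v≡u
  ... | inj₂ (zero , refl) = contradiction refl (adj⇒≢ G 0~u)
  ... | inj₂ (suc zero , refl) =
    contradiction (trans (sym 0~u) (trans (adj-label (λ ()))
                    (cong₂ (λ a b → true xor (a ∧ b)) (start-attached deg≥2) (end-attached deg≥2))))
                  λ ()
degreeTwo⇒⊥ {suc zero} G paths deg≥2 v deg≡2 = X.pivotAdj-isolated⇒⊥ (label-≢ λ ()) l₂-isolated
  where
  open Labelling G v (paths v)
  p₁ p₂ : Fin 3
  p₁ = suc zero
  p₂ = suc (suc zero)
  x = label zero
  module X = Labelling G x (paths x)
  0-att : attached zero ≡ true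
  0-att = start-attached deg≥2
  2-att : attached p₂ ≡ true
  2-att = end-attached deg≥2
  1-free : attached p₁ ≡ false
  1-free = ¬-not λ 1-att →
    exactlyTwo-noThird deg≡2 (label-≢ λ ()) (label-≢ λ ()) (label-≢ λ ()) 0-att 1-att 2-att
  x~l₂ : adj G x (label p₂) ≡ true
  x~l₂ rewrite adj-label {zero} {p₂} (λ ()) | 0-att | 2-att = refl
  l₂-isolated : ∀ y → x ≢ y → label p₂ ≢ y → pivotAdj G x (label p₂) y ≡ false
  l₂-isolated y x≢y l₂≢y with view y
  ... | inj₁ refl rewrite adj-sym G (label p₂) v | 2-att | x~l₂ | adj-sym G x v | 0-att = refl
  ... | inj₂ (zero , refl) = contradiction refl x≢y
  ... | inj₂ (suc zero , refl)
    rewrite adj-label {p₂} {p₁} (λ ()) | x~l₂ | adj-label {zero} {p₁} (λ ()) | 0-att | 1-free | 2-att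
    = refl
  ... | inj₂ (suc (suc zero) , refl) = contradiction refl l₂≢y
degreeTwo⇒⊥ {suc (suc n)} G paths deg≥2 v deg≡2 =
  P.pivotAdj-triangleFree (label-≢ λ ()) (pivot≢label p ∘ sym) (label-≢ λ ())
                          (pivot≢label zero ∘ sym) (pivot≢label end) (label-≢ λ ())
                          start~v v~end start~end
  where
  open Labelling G v (paths v)
  p end : Fin (4 + n)
  p = suc zero
  end = fromℕ (3 + n)
  module P = Labelling G (label p) (paths (label p))
  0-att : attached zero ≡ true
  0-att = start-attached deg≥2
  end-att : attached end ≡ true
  end-att = end-attached deg≥2
  p-free : attached p ≡ false
  p-free = ¬-not λ p-att →
    exactlyTwo-noThird deg≡2 (label-≢ λ ()) (label-≢ λ ()) (label-≢ λ ()) 0-att p-att end-att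
  p≁v : adj G (label p) v ≡ false
  p≁v = trans (adj-sym G _ v) p-free
  p~start : adj G (label p) (label zero) ≡ true
  p~start rewrite adj-label {p} {zero} (λ ()) | p-free = refl
  start~v : pivotAdj G (label p) (label zero) v ≡ true
  start~v rewrite adj-sym G (label zero) v | 0-att | p~start | p≁v = refl
  v~end : pivotAdj G (label p) v (label end) ≡ true
  v~end rewrite end-att | p≁v = refl
  start~end : pivotAdj G (label p) (label zero) (label end) ≡ true
  start~end rewrite adj-label {zero} {end} (λ ()) | p~start | adj-label {p} {end} (λ ())
                  | 0-att | end-att | p-free = refl

degreeThree⇒⊥ : (G : Graph (3 + n)) → AllEliminationsPaths G → ¬ (∀ u → ThreeTrue (adj G u))
degreeThree⇒⊥ G paths deg≥3 = 0≁1 (complete (label zero) (label (suc zero)) (label-≢ λ ()))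
  where
  -- A vertex u not adjacent to x keeps its three neighbours in the elimination of x.
  complete : ∀ x u → x ≢ u → adj G x u ≡ true
  complete x u x≢u with Labelling.position G x (paths x) x≢u
  ... | k , refl = ¬-not λ k-free →
    path-degree≤2 k (Labelling.unattached-ThreeTrue G x (paths x) k-free (deg≥3 _))
  open Labelling G zero (paths zero)
  0≁1 : adj G (label zero) (label (suc zero)) ≢ true
  0≁1 0~1 = contradiction (trans (sym 0~1) (trans (adj-label (λ ()))
              (cong₂ (λ a b → true xor (a ∧ b)) (complete _ _ (pivot≢label zero))
                                                (complete _ _ (pivot≢label (suc zero)))))) λ ()

allEliminationsPaths⇒path : (G : Graph (3 + n)) → AllEliminationsPaths G → G ≅ pathGraph (3 + n)
allEliminationsPaths⇒path G paths with ∃⊎∀ (λ u → classify (adj G u))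
... | inj₁ (v , isolated) = ⊥-elim (isolated⇒⊥ G paths v isolated)
... | inj₂ deg≥1 with ∃⊎∀ deg≥1
...   | inj₁ (v , leaf) = leaf⇒path G paths v leaf
...   | inj₂ deg≥2 with ∃⊎∀ deg≥2
...     | inj₁ (v , deg≡2) = ⊥-elim (degreeTwo⇒⊥ G paths (atLeastTwo ∘ deg≥2) v deg≡2)
...     | inj₂ deg≥3       = ⊥-elim (degreeThree⇒⊥ G paths deg≥3)

repOrPath₂ : (G : Graph 2) → BoolRep G 0 ⊎ G ≅ pathGraph 2
repOrPath₂ G with adj G zero (suc zero) in 0~1
... | false = inj₁ ((λ ()) , no-edge)
  where
  no-edge : ∀ x y → x ≢ y → adj G x y ≡ false
  no-edge zero       zero       x≢y = contradiction refl x≢y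
  no-edge zero       (suc zero) _   = 0~1
  no-edge (suc zero) zero       _   = trans (adj-sym G _ _) 0~1
  no-edge (suc zero) (suc zero) x≢y = contradiction refl x≢y
... | true = inj₂ (Perm.id , edge)
  where
  edge : ∀ x y → adj G x y ≡ pathAdj x y
  edge zero       zero       = adj-irr G zero
  edge zero       (suc zero) = 0~1
  edge (suc zero) zero       = trans (adj-sym G _ _) 0~1
  edge (suc zero) (suc zero) = adj-irr G (suc zero)

repOrPath : ∀ n (G : Graph (2 + n)) → BoolRep G n ⊎ G ≅ pathGraph (2 + n)
repOrPath zero    G = repOrPath₂ G
repOrPath (suc n) G with ∃⊎∀ (λ v → repOrPath n (eliminate G v))
... | inj₁ (v , rep) = inj₁ (liftRep G v rep)
... | inj₂ paths     = inj₂ (allEliminationsPaths⇒path G paths)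

mainTheorem8 : ((n : ℕ) → 1 ≤ n → BoolDim≡ (pathGraph n) (n ∸ 1))
             × ((n : ℕ) → 2 ≤ n → (G : Graph n) → ¬ (G ≅ pathGraph n) → BoolDim≤ G (n ∸ 2))
mainTheorem8 = pathDim , nonPathDim
  where
  pathDim : (n : ℕ) → 1 ≤ n → BoolDim≡ (pathGraph n) (n ∸ 1)
  pathDim (suc m) _ = pathRep m , pathLowerBound m
  nonPathDim : (n : ℕ) → 2 ≤ n → (G : Graph n) → ¬ (G ≅ pathGraph n) → BoolDim≤ G (n ∸ 2)
  nonPathDim (suc zero) (s≤s ())
  nonPathDim (suc (suc m)) _ G G≇P with repOrPath m G
  ... | inj₁ rep = m , ≤-refl , rep
  ... | inj₂ G≅P = contradiction G≅P G≇P
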